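{- Let $n\ge 1$ be an integer. The extended Hamming graph $EH(n,2^n)$ is a Cayley graph, i.e., there exist a finite group $G$ and a subset $S\subseteq G\setminus\{1\}$ with $S=S^{ -1}$ such that $EH(n,2^n)$ is isomorphic to $\operatorname{Cay}(G,S)$.
   Context: Let $\Omega=\{0,1,\dots,2^n-1\}$. The Hamming graph $H(n,2^n)$ has vertex set $\Omega^n$, two $n$-tuples being adjacent if and only if they differ in exactly one coordinate. For $u=(u_1,\dots,u_n)\in\Omega^n$ define its complement $u^c=(2^n-1-u_1,\dots,2^n-1-u_n)$. The extended Hamming graph $EH(n,2^n)$ has vertex set $\Omega^n$ and edge set $E(H(n,2^n))\cup\{\{u,u^c\} : u\in\Omega^n,\ u\neq u^c\}$. For a finite group $G$ with identity $1$ and an inverse-closed subset $S\subseteq G\setminus\{1\}$, the Cayley graph $\operatorname{Cay}(G,S)$ has vertex set $G$ and edges $\{g,h\}$ with $g^{ -1}h\in S$. -}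

module Defs where

open import Level using (0ℓ)
open import Data.Nat using (ℕ; _^_; suc)
open import Data.Fin using (Fin; opposite)
open import Data.Vec using (Vec; map)
open import Data.Product using (Σ; ∃; ∃-syntax; _×_; _,_)
open import Data.Sum using (_⊎_)
open import Relation.Nullary using (¬_)
open import Relation.Binary.PropositionalEquality using (_≡_; _≢_)
open import Function.Bundles using (_⤖_; _⇔_; Bijection)
open import Algebra.Bundles using (Group)

record Graph : Set₁ where
  field
    V   : Set
    Adj : V → V → Set

open Graph public

Ω : ℕ → Set
Ω n = Fin (2 ^ n)

Tuple : ℕ → Set
Tuple n = Vec (Ω n) n

DifferInExactlyOne : ∀ {A : Set} {k : ℕ} → Vec A k → Vec A k → Set
DifferInExactlyOne {k = k} u v =
  Σ (Fin k) λ i → (Data.Vec.lookup u i ≢ Data.Vec.lookup v i)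
                × (∀ j → j ≢ i → Data.Vec.lookup u j ≡ Data.Vec.lookup v j)

complement : ∀ {n} → Tuple n → Tuple n
complement = map opposite

EH : ℕ → Graph
EH n = record
  { V   = Tuple n
  ; Adj = λ u v → DifferInExactlyOne u v ⊎ (v ≡ complement u × u ≢ complement u)
  }

Cay : (G : Group 0ℓ 0ℓ) → (Group.Carrier G → Set) → Graph
Cay G S = record { V = Carrier ; Adj = λ g h → S ((g ⁻¹) ∙ h) }
  where open Group G

_≅_ : Graph → Graph → Set
Γ ≅ Δ = Σ (V Γ ⤖ V Δ) λ f →
  ∀ u v → Adj Γ u v ⇔ Adj Δ (Bijection.to f u) (Bijection.to f v)

FiniteGroup : Group 0ℓ 0ℓ → Set
FiniteGroup G = (∀ x y → (x ≈ y) ⇔ (x ≡ y)) × (∃[ m ] (Carrier ⤖ Fin m))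
  where open Group G

IsCayleyGraph : Graph → Set₁
IsCayleyGraph Γ =
  Σ (Group 0ℓ 0ℓ) λ G → FiniteGroup G ×
  Σ (Group.Carrier G → Set) λ S →
    (¬ S (Group.ε G)) ×
    (∀ s → S s → S (Group._⁻¹ G s)) ×
    (Γ ≅ Cay G S)

-- Read Ω = Fin (2^n) as n-digit binary numerals; then opposite complements every digit, i.e. it
-- is translation by the all-ones vector in (ℤ/2)^n.  Transporting this group to Ω and taking
-- its n-th power, both kinds of edges of EH(n,2^n) are preserved by left translations, and a
-- graph on a group invariant under left translations is the Cayley graph of the neighbourhood
-- of the identity.
module Submission where

open import Defs
open import Level using (0ℓ)
open import Data.Nat using (ℕ; zero; suc; _+_; _*_; _^_; _∸_; _<_; _≥_)
open import Data.Nat.Properties using (m+[n∸m]≡n; m+n∸m≡n)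
open import Data.Nat.Tactic.RingSolver using (solve-∀)
open import Data.Fin using (Fin; toℕ; opposite; combine; remQuot)
open import Data.Fin.Patterns using (0F; 1F)
open import Data.Fin.Properties
  using (toℕ-injective; toℕ<n; opposite-prop; opposite-involutive; toℕ-combine; remQuot-combine; combine-remQuot)
open import Data.Product using (Σ; ∃-syntax; _,_; proj₁; proj₂)
open import Data.Sum using (inj₁; inj₂)
open import Data.Vec using (Vec; []; _∷_; map; zipWith; replicate; lookup)
open import Data.Vec.Properties
  using (map-cong; map-∘; map-id; lookup-zipWith; zipWith-replicate₂;
         zipWith-assoc; zipWith-identityˡ; zipWith-identityʳ; zipWith-inverseˡ; zipWith-inverseʳ)
open import Algebra.Bundles using (Group)
open import Algebra.Core using (Op₁; Op₂)
open import Algebra.Definitions using (LeftCancellative)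
open import Algebra.Structures using (IsGroup)
open import Algebra.Morphism.Structures using (IsGroupMonomorphism)
import Algebra.Morphism.GroupMonomorphism as GroupMonomorphism
import Algebra.Properties.Group as GroupProperties
open import Function using (id; _∘_)
open import Function.Bundles using (_↔_; _⤖_; Inverse; mk↔ₛ′; mk⇔)
open import Function.Properties.Inverse using (↔⇒⤖)
open import Function.Construct.Identity using (⤖-id)
open import Relation.Binary.Definitions using (Irreflexive; Symmetric)
open import Relation.Binary.PropositionalEquality

mixed-radix-complement : ∀ {k m a b} → a < k → b < m →
                         k * m ∸ suc (m * a + b) ≡ m * (k ∸ suc a) + (m ∸ suc b)
mixed-radix-complement {k} {m} {a} {b} a<k b<m = begin
  k * m ∸ suc (m * a + b)                          ≡⟨ cong (_∸ suc (m * a + b)) product-split ⟩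
  suc (m * a + b) + (m * d + e) ∸ suc (m * a + b)  ≡⟨ m+n∸m≡n (suc (m * a + b)) (m * d + e) ⟩
  m * d + e                                        ∎
  where
  open ≡-Reasoning
  d = k ∸ suc a
  e = m ∸ suc b

  expand : ∀ a b d e → (suc a + d) * suc (b + e) ≡ suc (suc (b + e) * a + b) + (suc (b + e) * d + e)
  expand = solve-∀

  product-split : k * m ≡ suc (m * a + b) + (m * d + e)
  product-split = subst₂ (λ k m → k * m ≡ suc (m * a + b) + (m * d + e))
                         (m+[n∸m]≡n a<k) (m+[n∸m]≡n b<m) (expand a b d e)

opposite-combine : ∀ {k m} (i : Fin k) (j : Fin m) →
                   opposite (combine i j) ≡ combine (opposite i) (opposite j)
opposite-combine {k} {m} i j = toℕ-injective (begin
  toℕ (opposite (combine i j))                ≡⟨ opposite-prop (combine i j) ⟩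
  k * m ∸ suc (toℕ (combine i j))             ≡⟨ cong (λ c → k * m ∸ suc c) (toℕ-combine i j) ⟩
  k * m ∸ suc (m * toℕ i + toℕ j)             ≡⟨ mixed-radix-complement (toℕ<n i) (toℕ<n j) ⟩
  m * (k ∸ suc (toℕ i)) + (m ∸ suc (toℕ j))   ≡⟨ cong₂ (λ a b → m * a + b) (opposite-prop i) (opposite-prop j) ⟨
  m * toℕ (opposite i) + toℕ (opposite j)     ≡⟨ toℕ-combine (opposite i) (opposite j) ⟨
  toℕ (combine (opposite i) (opposite j))     ∎)
  where open ≡-Reasoning

module _ {k : ℕ} where

  fromDigits : ∀ {m} → Vec (Fin k) m → Fin (k ^ m)
  fromDigits []       = 0F
  fromDigits (d ∷ ds) = combine d (fromDigits ds)

  toDigits : ∀ m → Fin (k ^ m) → Vec (Fin k) m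
  toDigits zero    _ = []
  toDigits (suc m) x = proj₁ (remQuot {k} (k ^ m) x) ∷ toDigits m (proj₂ (remQuot {k} (k ^ m) x))

  toDigits-fromDigits : ∀ {m} (ds : Vec (Fin k) m) → toDigits m (fromDigits ds) ≡ ds
  toDigits-fromDigits []       = refl
  toDigits-fromDigits {suc m} (d ∷ ds) =
    cong₂ _∷_ (cong proj₁ split) (trans (cong (toDigits m ∘ proj₂) split) (toDigits-fromDigits ds))
    where split = remQuot-combine {k} {k ^ m} d (fromDigits ds)

  fromDigits-toDigits : ∀ m (x : Fin (k ^ m)) → fromDigits (toDigits m x) ≡ x
  fromDigits-toDigits zero    0F = refl
  fromDigits-toDigits (suc m) x =
    trans (cong (combine d) (fromDigits-toDigits m x′)) (combine-remQuot {k} (k ^ m) x)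
    where open Σ (remQuot {k} (k ^ m) x) renaming (proj₁ to d; proj₂ to x′)

  digits : ∀ m → Vec (Fin k) m ↔ Fin (k ^ m)
  digits m = mk↔ₛ′ fromDigits (toDigits m) (fromDigits-toDigits m) toDigits-fromDigits

  opposite-fromDigits : ∀ {m} (ds : Vec (Fin k) m) → opposite (fromDigits ds) ≡ fromDigits (map opposite ds)
  opposite-fromDigits []       = refl
  opposite-fromDigits (d ∷ ds) =
    trans (opposite-combine d (fromDigits ds)) (cong (combine (opposite d)) (opposite-fromDigits ds))

infixl 6 _+₂_
_+₂_ : Op₂ (Fin 2)
0F +₂ y = y
1F +₂ y = opposite y

+₂-isGroup : IsGroup _≡_ _+₂_ 0F id
+₂-isGroup = record
  { isMonoid = record
    { isSemigroup = record
      { isMagma = record { isEquivalence = isEquivalence ; ∙-cong = cong₂ _+₂_ }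
      ; assoc   = assoc }
    ; identity = (λ _ → refl) , identityʳ }
  ; inverse = self-inverse , self-inverse
  ; ⁻¹-cong = id }
  where
  assoc : ∀ x y z → (x +₂ y) +₂ z ≡ x +₂ (y +₂ z)
  assoc 0F y z = refl
  assoc 1F 0F z = refl
  assoc 1F 1F 0F = refl
  assoc 1F 1F 1F = refl
  identityʳ : ∀ x → x +₂ 0F ≡ x
  identityʳ 0F = refl
  identityʳ 1F = refl
  self-inverse : ∀ x → x +₂ x ≡ 0F
  self-inverse 0F = refl
  self-inverse 1F = refl

opposite≗+₂1 : ∀ x → opposite x ≡ x +₂ 1F
opposite≗+₂1 0F = refl
opposite≗+₂1 1F = refl

module _ {A : Set} {_∙_ : Op₂ A} {ε : A} {_⁻¹ : Op₁ A} where

  zipWith-isGroup : ∀ {m} → IsGroup _≡_ _∙_ ε _⁻¹ →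
                    IsGroup {A = Vec A m} _≡_ (zipWith _∙_) (replicate m ε) (map _⁻¹)
  zipWith-isGroup isGroup = record
    { isMonoid = record
      { isSemigroup = record
        { isMagma = record { isEquivalence = isEquivalence ; ∙-cong = cong₂ (zipWith _∙_) }
        ; assoc   = zipWith-assoc assoc }
      ; identity = zipWith-identityˡ identityˡ , zipWith-identityʳ identityʳ }
    ; inverse = zipWith-inverseˡ inverseˡ , zipWith-inverseʳ inverseʳ
    ; ⁻¹-cong = cong (map _⁻¹) }
    where open IsGroup isGroup using (assoc; identityˡ; identityʳ; inverseˡ; inverseʳ)

  isGroup⇒cancelˡ : IsGroup _≡_ _∙_ ε _⁻¹ → LeftCancellative _≡_ _∙_
  isGroup⇒cancelˡ isGroup = GroupProperties.∙-cancelˡ (record { isGroup = isGroup })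

module Transport {A B : Set} (φ : A ↔ B) {_∙_ : Op₂ A} {ε : A} {_⁻¹ : Op₁ A}
                 (isGroup : IsGroup _≡_ _∙_ ε _⁻¹) where

  open Inverse φ

  _∙ᵗ_ : Op₂ B
  x ∙ᵗ y = to (from x ∙ from y)

  _⁻¹ᵗ : Op₁ B
  x ⁻¹ᵗ = to (from x ⁻¹)

  from-isGroupMonomorphism :
    IsGroupMonomorphism (record { _≈_ = _≡_ ; _∙_ = _∙ᵗ_ ; ε = to ε ; _⁻¹ = _⁻¹ᵗ })
                        (record { _≈_ = _≡_ ; _∙_ = _∙_ ; ε = ε ; _⁻¹ = _⁻¹ }) from
  from-isGroupMonomorphism = record
    { isGroupHomomorphism = record
      { isMonoidHomomorphism = record
        { isMagmaHomomorphism = record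
          { isRelHomomorphism = record { cong = cong from }
          ; homo = λ x y → strictlyInverseʳ (from x ∙ from y) }
        ; ε-homo = strictlyInverseʳ ε }
      ; ⁻¹-homo = λ x → strictlyInverseʳ (from x ⁻¹) }
    ; injective = λ {x} {y} p → trans (sym (strictlyInverseˡ x)) (trans (cong to p) (strictlyInverseˡ y)) }

  isGroupᵗ : IsGroup _≡_ _∙ᵗ_ (to ε) _⁻¹ᵗ
  isGroupᵗ = GroupMonomorphism.isGroup from-isGroupMonomorphism isGroup

  rightTranslationᵗ : ∀ {σ : Op₁ A} {τ : Op₁ B} c → (∀ a → σ a ≡ a ∙ c) → (∀ a → to (σ a) ≡ τ (to a)) →
                      ∀ x → τ x ≡ x ∙ᵗ to c
  rightTranslationᵗ {σ} {τ} c σ≗∙c to∘σ≗τ∘to x = begin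
    τ x                        ≡⟨ cong τ (strictlyInverseˡ x) ⟨
    τ (to (from x))            ≡⟨ to∘σ≗τ∘to (from x) ⟨
    to (σ (from x))            ≡⟨ cong to (σ≗∙c (from x)) ⟩
    to (from x ∙ c)            ≡⟨ cong (λ c′ → to (from x ∙ c′)) (strictlyInverseʳ c) ⟨
    to (from x ∙ from (to c))  ∎
    where open ≡-Reasoning

module _ (Γ : Graph) {_∙_ : Op₂ (V Γ)} {ε : V Γ} {_⁻¹ : Op₁ (V Γ)}
         (isGroup : IsGroup _≡_ _∙_ ε _⁻¹) where

  open IsGroup isGroup using (identityʳ; inverseˡ)

  translationInvariant⇒isCayleyGraph :
    ∃[ m ] (V Γ ⤖ Fin m) → Irreflexive _≡_ (Adj Γ) → Symmetric (Adj Γ) →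
    (∀ g {u v} → Adj Γ u v → Adj Γ (g ∙ u) (g ∙ v)) → IsCayleyGraph Γ
  translationInvariant⇒isCayleyGraph finite irrefl symmetric translate =
    G , ((λ _ _ → mk⇔ id id) , finite) , Adj Γ ε , irrefl refl , ⁻¹-closed ,
    ⤖-id (V Γ) , λ u v → mk⇔ toε fromε
    where
    G : Group 0ℓ 0ℓ
    G = record { isGroup = isGroup }

    toε : ∀ {u v} → Adj Γ u v → Adj Γ ε ((u ⁻¹) ∙ v)
    toε {u} {v} a = subst (λ w → Adj Γ w ((u ⁻¹) ∙ v)) (inverseˡ u) (translate (u ⁻¹) a)

    fromε : ∀ {u v} → Adj Γ ε ((u ⁻¹) ∙ v) → Adj Γ u v
    fromε {u} {v} a = subst₂ (Adj Γ) (identityʳ u) (GroupProperties.\\-leftDividesˡ G u v) (translate u a)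

    ⁻¹-closed : ∀ s → Adj Γ ε s → Adj Γ ε (s ⁻¹)
    ⁻¹-closed s a = subst (Adj Γ ε) (identityʳ (s ⁻¹)) (toε (symmetric a))

module _ {A : Set} {k : ℕ} where

  DifferInExactlyOne-irrefl : Irreflexive _≡_ (DifferInExactlyOne {A} {k})
  DifferInExactlyOne-irrefl refl (_ , ≢ , _) = ≢ refl

  DifferInExactlyOne-sym : Symmetric (DifferInExactlyOne {A} {k})
  DifferInExactlyOne-sym (i , ≢ , ≡ᵢ) = i , ≢ ∘ sym , λ j j≢i → sym (≡ᵢ j j≢i)

  DifferInExactlyOne-translate : ∀ {_∙_ : Op₂ A} → LeftCancellative _≡_ _∙_ →
    ∀ (g : Vec A k) {u v} → DifferInExactlyOne u v → DifferInExactlyOne (zipWith _∙_ g u) (zipWith _∙_ g v)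
  DifferInExactlyOne-translate {_∙_} cancelˡ g {u} {v} (i , ≢ , ≡ᵢ) =
    i , (λ p → ≢ (cancelˡ (lookup g i) _ _ (trans (sym (lookup∙ u i)) (trans p (lookup∙ v i))))) ,
    λ j j≢i → trans (lookup∙ u j) (trans (cong (lookup g j ∙_) (≡ᵢ j j≢i)) (sym (lookup∙ v j)))
    where
    lookup∙ : ∀ w i → lookup (zipWith _∙_ g w) i ≡ lookup g i ∙ lookup w i
    lookup∙ w i = lookup-zipWith _∙_ i g w

module _ {n : ℕ} where

  complement-involutive : ∀ (u : Tuple n) → complement (complement u) ≡ u
  complement-involutive u =
    trans (sym (map-∘ opposite opposite u)) (trans (map-cong opposite-involutive u) (map-id u))

  EH-irrefl : Irreflexive _≡_ (Adj (EH n))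
  EH-irrefl {u} refl (inj₁ d)        = DifferInExactlyOne-irrefl {x = u} refl d
  EH-irrefl refl (inj₂ (u≡uᶜ , u≢uᶜ)) = u≢uᶜ u≡uᶜ

  EH-sym : Symmetric (Adj (EH n))
  EH-sym {u} {v} (inj₁ d)         = inj₁ (DifferInExactlyOne-sym {x = u} {y = v} d)
  EH-sym {u} (inj₂ (refl , u≢uᶜ)) =
    inj₂ (sym (complement-involutive u) , λ p → u≢uᶜ (sym (trans p (complement-involutive u))))

  module _ {_∙_ : Op₂ (Ω n)} {ε : Ω n} {_⁻¹ : Op₁ (Ω n)} (isGroup : IsGroup _≡_ _∙_ ε _⁻¹)
           {c : Ω n} (opposite≗∙c : ∀ x → opposite x ≡ x ∙ c) where

    open IsGroup isGroup using (assoc)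

    complement-translate : ∀ {m} (g u : Vec (Ω n) m) →
                           map opposite (zipWith _∙_ g u) ≡ zipWith _∙_ g (map opposite u)
    complement-translate []      []      = refl
    complement-translate (x ∷ g) (y ∷ u) = cong₂ _∷_ opposite-translate (complement-translate g u)
      where
      opposite-translate : opposite (x ∙ y) ≡ x ∙ opposite y
      opposite-translate = begin
        opposite (x ∙ y) ≡⟨ opposite≗∙c (x ∙ y) ⟩
        (x ∙ y) ∙ c      ≡⟨ assoc x y c ⟩
        x ∙ (y ∙ c)      ≡⟨ cong (x ∙_) (opposite≗∙c y) ⟨
        x ∙ opposite y   ∎
        where open ≡-Reasoning

    EH-translate : ∀ g {u v} → Adj (EH n) u v → Adj (EH n) (zipWith _∙_ g u) (zipWith _∙_ g v)
    EH-translate g (inj₁ d) = inj₁ (DifferInExactlyOne-translate (isGroup⇒cancelˡ isGroup) g d)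
    EH-translate g {u} (inj₂ (refl , u≢uᶜ)) =
      inj₂ ( sym (complement-translate g u)
           , λ p → u≢uᶜ (isGroup⇒cancelˡ (zipWith-isGroup isGroup) g _ _ (trans p (complement-translate g u))))

module _ (n : ℕ) where

  open Transport (digits {2} n) (zipWith-isGroup +₂-isGroup)

  Ω-isGroup : IsGroup _≡_ _∙ᵗ_ (fromDigits (replicate n 0F)) _⁻¹ᵗ
  Ω-isGroup = isGroupᵗ

  opposite≗∙ᵗ1 : ∀ x → opposite x ≡ x ∙ᵗ fromDigits (replicate n 1F)
  opposite≗∙ᵗ1 = rightTranslationᵗ (replicate n 1F)
    (λ a → trans (map-cong opposite≗+₂1 a) (sym (zipWith-replicate₂ _+₂_ a 1F)))
    (λ a → sym (opposite-fromDigits a))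

theorem4p2 : (n : ℕ) → n ≥ 1 → IsCayleyGraph (EH n)
theorem4p2 n _ =
  translationInvariant⇒isCayleyGraph (EH n) (zipWith-isGroup (Ω-isGroup n))
    (_ , ↔⇒⤖ (digits n)) EH-irrefl EH-sym (EH-translate (Ω-isGroup n) (opposite≗∙ᵗ1 n))
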